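{- Let $\Pi$ be a projective plane of order $n$ and $k \geq 4$. Then $$|B_k(\Pi)| \leq (k-1)(k-2)N_{(k-1)}.$$
   Context: $N = n^2+n+1$ is the number of points (and of lines) of $\Pi$; for a positive integer $x$, $x_{(m)} = x(x-1)\cdots(x-m+1)$. For distinct points $A, B$, $AB$ denotes the line through them. A quasi $k$-gon is a sequence $(P_1, \dots, P_k)$ of $k$ distinct points of $\Pi$, with indices read modulo $k$; $\mathcal{L}_{QG_k}$ denotes the set of distinct lines among $P_1P_2, P_2P_3, \dots, P_kP_1$. $B_k(\Pi)$ is the set of quasi $k$-gons $QG_k = (P_1, \dots, P_k)$ with $|\mathcal{L}_{QG_k}| = k-1$ and such that $P_mP_{m+1} \neq P_{m+1}P_{m+2}$ for all $m$ (indices modulo $k$). -}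

module Defs where

open import Data.Nat using (ℕ; zero; suc; _+_; _*_; _∸_)
open import Data.Fin using (Fin; zero; suc; fromℕ; inject₁; _≟_)
open import Data.Fin.Properties using () renaming (_≟_ to _≟F_)
open import Data.Vec using (Vec; lookup)
open import Data.List using (List; length; map; filter; allFin; deduplicate)
open import Data.Product using (Σ; _×_; _,_; ∃)
open import Relation.Nullary using (¬_; Dec; yes; no)
open import Relation.Binary.PropositionalEquality using (_≡_; _≢_)

-- N = n² + n + 1, the number of points (and of lines) of a projective plane of order n
N : ℕ → ℕ
N n = suc (n * n + n)

record ProjectivePlane (n : ℕ) : Set₁ where
  field
    -- incidence: I P L means "point P lies on line L"
    I      : Fin (N n) → Fin (N n) → Set
    I?     : ∀ P L → Dec (I P L)
    join       : (A B : Fin (N n)) → A ≢ B → Fin (N n)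
    join-incˡ  : ∀ A B (p : A ≢ B) → I A (join A B p)
    join-incʳ  : ∀ A B (p : A ≢ B) → I B (join A B p)
    join-uniq  : ∀ A B (p : A ≢ B) L → I A L → I B L → L ≡ join A B p
    meet       : (L M : Fin (N n)) → L ≢ M → Fin (N n)
    meet-incˡ  : ∀ L M (p : L ≢ M) → I (meet L M p) L
    meet-incʳ  : ∀ L M (p : L ≢ M) → I (meet L M p) M
    meet-uniq  : ∀ L M (p : L ≢ M) P → I P L → I P M → P ≡ meet L M p
    quadrangle : Σ (Vec (Fin (N n)) 4) λ q →
                   (∀ i j → lookup q i ≡ lookup q j → i ≡ j) ×
                   (∀ i j k → i ≢ j → j ≢ k → i ≢ k → ∀ L →
                      ¬ (I (lookup q i) L × I (lookup q j) L × I (lookup q k) L))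
    line-size  : ∀ L → length (filter (λ P → I? P L) (allFin (N n))) ≡ suc n

next : ∀ {k} → Fin k → Fin k
next {suc k} i with i ≟ fromℕ k
... | yes _ = zero
... | no  _ = nextAux i
  where
  nextAux : ∀ {m} → Fin (suc m) → Fin (suc m)
  nextAux {zero}  zero    = zero
  nextAux {suc m} zero    = suc zero
  nextAux {suc m} (suc j) = suc (nextAux j)

module _ {n : ℕ} (Π : ProjectivePlane n) where
  open ProjectivePlane Π

  -- the line AB through two points (meaningful for A ≢ B; arbitrary value otherwise)
  lineThrough : Fin (N n) → Fin (N n) → Fin (N n)
  lineThrough A B with A ≟ B
  ... | yes _ = zero
  ... | no p  = join A B p

  IsQuasiGon : (k : ℕ) → Vec (Fin (N n)) k → Set
  IsQuasiGon k P = ∀ i j → lookup P i ≡ lookup P j → i ≡ j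

  sideLines : (k : ℕ) → Vec (Fin (N n)) k → List (Fin (N n))
  sideLines k P = map (λ i → lineThrough (lookup P i) (lookup P (next i))) (allFin k)

  numSideLines : (k : ℕ) → Vec (Fin (N n)) k → ℕ
  numSideLines k P = length (deduplicate _≟_ (sideLines k P))

  InB : (k : ℕ) → Vec (Fin (N n)) k → Set
  InB k P = IsQuasiGon k P
          × numSideLines k P ≡ k ∸ 1
          × (∀ m → lineThrough (lookup P m) (lookup P (next m))
                   ≢ lineThrough (lookup P (next m)) (lookup P (next (next m))))

-- Some side of a member of B_k(Π) lies on the same line as another, non-adjacent side:
-- if every side were on its own line there would be k lines, and adjacent sides are on
-- different lines by definition. Choosing the index i of that side among the k - 1 indices
-- other than the last one (swap the two sides if necessary), and the index j of the other
-- side among the k - 2 indices different from i and i + 1, it remains to count the quasi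
-- k-gons in which P_j and P_{j+1} lie on the line P_i P_{i+1}. There are N choices for
-- P_i, N - 1 for P_{i+1}, then n - 1 and n - 2 choices for P_j and P_{j+1} on that line
-- and (N - 4)_{(k-4)} for the remaining points, and this product is at most N_{(k-1)}.
module Submission where

open import Defs
import Algebra.Properties.CommutativeSemigroup as CommSemigroupProperties
open import Data.Bool.Base using (true; false; T)
open import Data.Empty using (⊥; ⊥-elim)
open import Data.Fin using (Fin; zero; suc; toℕ; fromℕ; _≟_)
import Data.Fin.Properties as Finₚ
open import Data.List using (List; []; _∷_; length; map; filter; foldr; allFin; deduplicate)
open import Data.List.Membership.Propositional using (_∈_; _∉_; lose)
open import Data.List.Membership.Propositional.Properties using (∈-filter⁺; ∈-filter⁻; ∈-allFin)
open import Data.List.Properties using (length-map; length-tabulate; filter-all)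
open import Data.List.Relation.Binary.Sublist.Propositional using (_⊆_)
import Data.List.Relation.Binary.Sublist.Propositional.Properties as Sublist
open import Data.List.Relation.Unary.All using (All; []; _∷_)
import Data.List.Relation.Unary.All as All
open import Data.List.Relation.Unary.All.Properties
  using (all-filter; ¬Any⇒All¬) renaming (filter⁺ to all-filter⁺)
open import Data.List.Relation.Unary.Any using (Any; here; there)
import Data.List.Relation.Unary.Any as Any
open import Data.List.Relation.Unary.Unique.Propositional using (Unique; []; _∷_)
import Data.List.Relation.Unary.Unique.Propositional.Properties as Unique
open import Data.Nat using (ℕ; zero; suc; pred; _+_; _*_; _∸_; _≤_; _<_; _≤ᵇ_; z≤n; s≤s)
open import Data.Nat.Combinatorics using (_P_)
open import Data.Nat.Combinatorics.Base using (_P′_)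
open import Data.Nat.Properties hiding (_≟_)
open import Data.Product using (∃₂; _×_; _,_; proj₁; proj₂)
open import Data.Vec using (Vec; lookup; tabulate)
open import Data.Vec.Properties using (tabulate∘lookup; tabulate-cong)
open import Function using (_∘_; id)
open import Function.Definitions using (Injective)
open import Level using (0ℓ)
open import Relation.Binary.PropositionalEquality
  using (_≡_; _≢_; refl; sym; trans; cong; cong₂; subst; subst₂; module ≡-Reasoning)
open import Relation.Nullary using (Dec; yes; no; ¬?)
open import Relation.Nullary.Decidable using (_×-dec_)
open import Relation.Unary using (Pred; Decidable; _∩_)
open import Relation.Unary.Properties using (∁?)

fallingFactorial : ℕ → ℕ → ℕ
fallingFactorial n zero    = 1
fallingFactorial n (suc k) = n * fallingFactorial (n ∸ 1) k

fallingFactorial-monoˡ-≤ : ∀ {m n} k → m ≤ n → fallingFactorial m k ≤ fallingFactorial n k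
fallingFactorial-monoˡ-≤ zero    m≤n = ≤-refl
fallingFactorial-monoˡ-≤ (suc k) m≤n =
  *-mono-≤ m≤n (fallingFactorial-monoˡ-≤ k (∸-monoˡ-≤ 1 m≤n))

fallingFactorial-sucʳ : ∀ n k → fallingFactorial n (suc k) ≡ (n ∸ k) * fallingFactorial n k
fallingFactorial-sucʳ n zero    = refl
fallingFactorial-sucʳ n (suc k) = begin
  n * fallingFactorial (n ∸ 1) (suc k)
    ≡⟨ cong (n *_) (fallingFactorial-sucʳ (n ∸ 1) k) ⟩
  n * ((n ∸ 1 ∸ k) * fallingFactorial (n ∸ 1) k)
    ≡⟨ x∙yz≈y∙xz n (n ∸ 1 ∸ k) _ ⟩
  (n ∸ 1 ∸ k) * fallingFactorial n (suc k)
    ≡⟨ cong (_* fallingFactorial n (suc k)) (∸-+-assoc n 1 k) ⟩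
  (n ∸ suc k) * fallingFactorial n (suc k) ∎
  where
  open ≡-Reasoning
  open CommSemigroupProperties *-commutativeSemigroup using (x∙yz≈y∙xz)

fallingFactorial≡P′ : ∀ n k → fallingFactorial n k ≡ n P′ k
fallingFactorial≡P′ n zero    = refl
fallingFactorial≡P′ n (suc k) =
  trans (fallingFactorial-sucʳ n k) (cong ((n ∸ k) *_) (fallingFactorial≡P′ n k))

fallingFactorial-≡0 : ∀ {n k} → n < k → fallingFactorial n k ≡ 0
fallingFactorial-≡0 {zero}  {suc k} _        = refl
fallingFactorial-≡0 {suc n} {suc k} (s≤s n<k) =
  trans (cong (suc n *_) (fallingFactorial-≡0 n<k)) (*-zeroʳ (suc n))

fallingFactorial≡P : ∀ n k → fallingFactorial n k ≡ n P k
fallingFactorial≡P n k with k ≤ᵇ n in k≤ᵇn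
... | true  = fallingFactorial≡P′ n k
... | false = fallingFactorial-≡0 {n} {k} (≰⇒> λ k≤n → subst T k≤ᵇn (≤⇒≤ᵇ k≤n))

[n∸1]*[n∸2]≤n*n+n∸1 : ∀ n → (n ∸ 1) * (n ∸ 2) ≤ n * n + n ∸ 1
[n∸1]*[n∸2]≤n*n+n∸1 zero    = z≤n
[n∸1]*[n∸2]≤n*n+n∸1 (suc n) = begin
  n * (n ∸ 1)               ≤⟨ *-monoʳ-≤ n (≤-trans (m∸n≤m n 1) (n≤1+n n)) ⟩
  n * suc n                 ≤⟨ m≤n+m _ n ⟩
  n + n * suc n             ≤⟨ m≤m+n _ (suc n) ⟩
  n + n * suc n + suc n     ∎
  where open ≤-Reasoning

length-filter+filter∁ : ∀ {A : Set} {P : Pred A 0ℓ} (P? : Decidable P) xs →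
                        length (filter P? xs) + length (filter (∁? P?) xs) ≡ length xs
length-filter+filter∁ P? []       = refl
length-filter+filter∁ P? (x ∷ xs) with P? x
... | yes _ = cong suc (length-filter+filter∁ P? xs)
... | no  _ = trans (+-suc _ _) (cong suc (length-filter+filter∁ P? xs))

union-bound : ∀ {A B : Set} {Q : B → A → Set} (Q? : ∀ b → Decidable (Q b)) (S : List B)
              (xs : List A) {K : ℕ} → All (λ x → Any (λ b → Q b x) S) xs →
              (∀ {b} → b ∈ S → length (filter (Q? b) xs) ≤ K) → length xs ≤ length S * K
union-bound Q? []      []      _       _     = z≤n
union-bound Q? []      (_ ∷ _) (() ∷ _) _
union-bound {A} {Q = Q} Q? (b ∷ S) xs {K} covered bound = begin
  length xs
    ≡⟨ length-filter+filter∁ (Q? b) xs ⟨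
  length (filter (Q? b) xs) + length others
    ≤⟨ +-mono-≤ (bound (here refl)) (union-bound Q? S others covered′ bound′) ⟩
  K + length S * K ∎
  where
  open ≤-Reasoning
  others : List A
  others = filter (∁? (Q? b)) xs
  covered′ : All (λ x → Any (λ b → Q b x) S) others
  covered′ = All.zipWith (λ where (¬Qbx , here Qbx) → ⊥-elim (¬Qbx Qbx)
                                  (_ , there Qb′x) → Qb′x)
                         (all-filter (∁? (Q? b)) xs , all-filter⁺ (∁? (Q? b)) covered)
  bound′ : ∀ {b′} → b′ ∈ S → length (filter (Q? b′) others) ≤ K
  bound′ {b′} b′∈S = ≤-trans (Sublist.length-mono-≤ sublist) (bound (there b′∈S))
    where
    sublist : filter (Q? b′) others ⊆ filter (Q? b′) xs
    sublist = Sublist.filter⁺ (Q? b′) (Q? b′) (λ { refl → id }) (Sublist.filter-⊆ (∁? (Q? b)) xs)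

module _ {m : ℕ} where

  open import Data.List.Membership.DecPropositional (_≟_ {m}) using (_∈?_)

  remove : Fin m → List (Fin m) → List (Fin m)
  remove r = filter (λ x → ¬? (x ≟ r))

  _∖_ : List (Fin m) → List (Fin m) → List (Fin m)
  U ∖ rs = foldr remove U rs

  ∈-remove⁺ : ∀ {r x U} → x ∈ U → x ≢ r → x ∈ remove r U
  ∈-remove⁺ {r} = ∈-filter⁺ (λ x → ¬? (x ≟ r))

  ∈-remove⁻ : ∀ {r x U} → x ∈ remove r U → x ∈ U × x ≢ r
  ∈-remove⁻ {r} = ∈-filter⁻ (λ x → ¬? (x ≟ r))

  remove-unique : ∀ {r U} → Unique U → Unique (remove r U)
  remove-unique {r} = Unique.filter⁺ (λ x → ¬? (x ≟ r))

  length-remove : ∀ {r U} → Unique U → r ∈ U → suc (length (remove r U)) ≡ length U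
  length-remove {r} {x ∷ U} (x∉U ∷ _) r∈ with x ≟ r
  ... | yes refl = cong suc (cong length (filter-all (λ y → ¬? (y ≟ r)) (All.map (_∘ sym) x∉U)))
  length-remove (_ ∷ uU) (here r≡x)  | no x≢r = ⊥-elim (x≢r (sym r≡x))
  length-remove (_ ∷ uU) (there r∈U) | no _   = cong suc (length-remove uU r∈U)

  ∈-∖⁺ : ∀ {x U rs} → x ∈ U → All (x ≢_) rs → x ∈ U ∖ rs
  ∈-∖⁺ x∈U []              = x∈U
  ∈-∖⁺ x∈U (x≢r ∷ x∉rs) = ∈-remove⁺ (∈-∖⁺ x∈U x∉rs) x≢r

  ∈-∖⁻ : ∀ {x} U rs → x ∈ U ∖ rs → x ∈ U × All (x ≢_) rs
  ∈-∖⁻ U []       x∈U = x∈U , []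
  ∈-∖⁻ U (r ∷ rs) x∈  =
    let x∈′ , x≢r = ∈-remove⁻ x∈ ; x∈U , x∉rs = ∈-∖⁻ U rs x∈′ in x∈U , x≢r ∷ x∉rs

  ∉-∖⇒∈ : ∀ {x U rs} → x ∈ U → x ∉ U ∖ rs → x ∈ rs
  ∉-∖⇒∈ {x} {rs = rs} x∈U x∉ with x ∈? rs
  ... | yes x∈rs = x∈rs
  ... | no  x∉rs = ⊥-elim (x∉ (∈-∖⁺ x∈U (¬Any⇒All¬ rs x∉rs)))

  ∖-unique : ∀ {U} rs → Unique U → Unique (U ∖ rs)
  ∖-unique []       uU = uU
  ∖-unique (r ∷ rs) uU = remove-unique (∖-unique rs uU)

  length-∖ : ∀ {U rs} → Unique U → Unique rs → All (_∈ U) rs →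
             length (U ∖ rs) ≡ length U ∸ length rs
  length-∖ _ [] [] = refl
  length-∖ {U} {r ∷ rs} uU (r∉rs ∷ urs) (r∈U ∷ rs⊆U) = begin
    length (remove r (U ∖ rs))    ≡⟨ cong pred (length-remove (∖-unique rs uU) (∈-∖⁺ r∈U r∉rs)) ⟩
    pred (length (U ∖ rs))        ≡⟨ cong pred (length-∖ uU urs rs⊆U) ⟩
    pred (length U ∸ length rs)   ≡⟨ pred[m∸n]≡m∸[1+n] (length U) (length rs) ⟩
    length U ∸ suc (length rs)    ∎
    where open ≡-Reasoning

length-allFin : ∀ m → length (allFin m) ≡ m
length-allFin m = length-tabulate id

length-allFin∖ : ∀ {m} (rs : List (Fin m)) → Unique rs → length (allFin m ∖ rs) ≡ m ∸ length rs
length-allFin∖ {m} rs urs =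
  trans (length-∖ (Unique.allFin⁺ m) urs (All.tabulate λ {r} _ → ∈-allFin r))
        (cong (_∸ length rs) (length-allFin m))

deduplicate-unique : ∀ {m} {xs : List (Fin m)} → Unique xs → deduplicate _≟_ xs ≡ xs
deduplicate-unique {xs = []}     []           = refl
deduplicate-unique {xs = x ∷ xs} (x∉xs ∷ uxs) = cong (x ∷_) (begin
  filter (λ y → ¬? (x ≟ y)) (deduplicate _≟_ xs) ≡⟨ cong (filter _) (deduplicate-unique uxs) ⟩
  filter (λ y → ¬? (x ≟ y)) xs                   ≡⟨ filter-all (λ y → ¬? (x ≟ y)) x∉xs ⟩
  xs                                             ∎)
  where open ≡-Reasoning

at-most-one : ∀ {A : Set} {xs : List A} → Unique xs →
              (∀ {x y} → x ∈ xs → y ∈ xs → x ≡ y) → length xs ≤ 1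
at-most-one {xs = []}         _                _  = z≤n
at-most-one {xs = _ ∷ []}     _                _  = s≤s z≤n
at-most-one {xs = _ ∷ _ ∷ _} ((x≢y ∷ _) ∷ _) eq = ⊥-elim (x≢y (eq (here refl) (there (here refl))))

module _ {m k : ℕ} where

  Distinct : Pred (Vec (Fin m) k) 0ℓ
  Distinct v = ∀ p q → lookup v p ≡ lookup v q → p ≡ q

  data Fixes : List (Fin k) → List (Fin m) → Pred (Vec (Fin m) k) 0ℓ where
    []  : ∀ {v} → Fixes [] [] v
    _∷_ : ∀ {q qs w ws v} → lookup v q ≡ w → Fixes qs ws v → Fixes (q ∷ qs) (w ∷ ws) v

  _at_≟_ : (v : Vec (Fin m) k) (p : Fin k) (α : Fin m) → Dec (lookup v p ≡ α)
  v at p ≟ α = lookup v p ≟ α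

  fixing : Fin k → Fin m → List (Vec (Fin m) k) → List (Vec (Fin m) k)
  fixing p α = filter (_at p ≟ α)

  fixing⁺ : ∀ {P : Pred (Vec (Fin m) k) 0ℓ} {p α qs ws ys} → All (Fixes qs ws ∩ P) ys →
             All (Fixes (p ∷ qs) (α ∷ ws) ∩ P) (fixing p α ys)
  fixing⁺ {p = p} {α} {ys = ys} h =
    All.zipWith (λ (e , fx , Pv) → e ∷ fx , Pv)
                (all-filter (_at p ≟ α) ys , all-filter⁺ (_at p ≟ α) h)

  fresh : ∀ {v p qs ws} → Distinct v → Fixes qs ws v → All (p ≢_) qs → All (lookup v p ≢_) ws
  fresh inj []       []           = []
  fresh inj (e ∷ fx) (p≢q ∷ p∉qs) = (λ e′ → p≢q (inj _ _ (trans e′ (sym e)))) ∷ fresh inj fx p∉qs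

  fixes-agree : ∀ {v w q qs ws} → Fixes qs ws v → Fixes qs ws w → q ∈ qs → lookup v q ≡ lookup w q
  fixes-agree (ev ∷ _)  (ew ∷ _)  (here refl) = trans ev (sym ew)
  fixes-agree (_ ∷ fxv) (_ ∷ fxw) (there q∈)  = fixes-agree fxv fxw q∈

  agreeing-injections-count :
    ∀ (ps : List (Fin k)) → Unique ps → (U : List (Fin m)) → Unique U →
    ∀ {ys} → Unique ys →
    (∀ {v w} → v ∈ ys → w ∈ ys → ∀ q → q ∉ ps → lookup v q ≡ lookup w q) →
    All (λ v → Distinct v × All (λ p → lookup v p ∈ U) ps) ys →
    length ys ≤ fallingFactorial (length U) (length ps)
  agreeing-injections-count [] _ U _ uy agree _ =
    at-most-one uy λ {v} {w} v∈ w∈ → begin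
      v                   ≡⟨ tabulate∘lookup v ⟨
      tabulate (lookup v) ≡⟨ tabulate-cong (λ q → agree v∈ w∈ q λ ()) ⟩
      tabulate (lookup w) ≡⟨ tabulate∘lookup w ⟩
      w                   ∎
    where open ≡-Reasoning
  agreeing-injections-count (p ∷ ps) (p∉ps ∷ ups) U uU {ys} uy agree h =
    union-bound (λ α → _at p ≟ α) U ys (All.map (λ { (_ , p∈U ∷ _) → p∈U }) h) bound
    where
    bound : ∀ {α} → α ∈ U → length (fixing p α ys) ≤ fallingFactorial (length U ∸ 1) (length ps)
    bound {α} α∈U =
      subst (λ u → length (fixing p α ys) ≤ fallingFactorial u (length ps))
            (cong pred (length-remove uU α∈U))
            (agreeing-injections-count ps ups (remove α U) (remove-unique uU)
               (Unique.filter⁺ (_at p ≟ α) uy) agree′ h′)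
      where
      agree′ : ∀ {v w} → v ∈ fixing p α ys → w ∈ fixing p α ys →
               ∀ q → q ∉ ps → lookup v q ≡ lookup w q
      agree′ v∈ w∈ q q∉ps with ∈-filter⁻ (_at p ≟ α) v∈ | ∈-filter⁻ (_at p ≟ α) w∈ | q ≟ p
      ... | _ , ev | _ , ew | yes refl = trans ev (sym ew)
      ... | v∈ys , _ | w∈ys , _ | no q≢p = agree v∈ys w∈ys q λ where
        (here q≡p)  → q≢p q≡p
        (there q∈) → q∉ps q∈
      h′ : All (λ v → Distinct v × All (λ p′ → lookup v p′ ∈ remove α U) ps) (fixing p α ys)
      h′ = All.zipWith
        (λ { (e , inj , _ ∷ onU) → inj , All.zipWith
          (λ (p≢p′ , p′∈U) → ∈-remove⁺ p′∈U λ e′ → p≢p′ (inj _ _ (trans e (sym e′))))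
          (p∉ps , onU) })
        (all-filter (_at p ≟ α) ys , all-filter⁺ (_at p ≟ α) h)

  extensions-count : ∀ {qs : List (Fin k)} {ws : List (Fin m)} → Unique qs → Unique ws →
                     ∀ {ys} → Unique ys → All (Fixes qs ws ∩ Distinct) ys →
                     length ys ≤ fallingFactorial (m ∸ length ws) (k ∸ length qs)
  extensions-count {qs} {ws} uq uw {ys} uy h =
    subst₂ (λ u f → length ys ≤ fallingFactorial u f) (length-allFin∖ ws uw) (length-allFin∖ qs uq)
      (agreeing-injections-count (allFin k ∖ qs) (∖-unique qs (Unique.allFin⁺ k))
         (allFin m ∖ ws) (∖-unique ws (Unique.allFin⁺ m)) uy agree (All.map values h))
    where
    agree : ∀ {v w} → v ∈ ys → w ∈ ys → ∀ q → q ∉ allFin k ∖ qs → lookup v q ≡ lookup w q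
    agree v∈ w∈ q q∉ =
      fixes-agree (proj₁ (All.lookup h v∈)) (proj₁ (All.lookup h w∈)) (∉-∖⇒∈ (∈-allFin q) q∉)
    values : ∀ {v} → (Fixes qs ws ∩ Distinct) v →
             Distinct v × All (λ p → lookup v p ∈ allFin m ∖ ws) (allFin k ∖ qs)
    values (fx , inj) = inj , All.tabulate λ p∈ →
      ∈-∖⁺ (∈-allFin _) (fresh inj fx (proj₂ (∈-∖⁻ (allFin k) qs p∈)))

next-fromℕ : ∀ {m} → next (fromℕ m) ≡ zero
next-fromℕ {m} with fromℕ m ≟ fromℕ m
... | yes _  = refl
... | no ¬refl = ⊥-elim (¬refl refl)

next-suc : ∀ {m} (j : Fin (suc m)) → j ≢ fromℕ m → next (suc j) ≡ suc (next j)
next-suc {m} j j≢last with suc j ≟ fromℕ (suc m) | j ≟ fromℕ m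
... | yes sj≡last | _          = ⊥-elim (j≢last (Finₚ.suc-injective sj≡last))
... | no _        | yes j≡last = ⊥-elim (j≢last j≡last)
... | no _        | no _       = refl

toℕ-next : ∀ {m} (i : Fin (suc m)) → i ≢ fromℕ m → toℕ (next i) ≡ suc (toℕ i)
toℕ-next {zero}  zero    i≢last = ⊥-elim (i≢last refl)
toℕ-next {suc m} zero    _      = refl
toℕ-next {suc m} (suc j) i≢last =
  trans (cong toℕ (next-suc j (i≢last ∘ cong suc))) (cong suc (toℕ-next j (i≢last ∘ cong suc)))

toℕ-next-last : ∀ {m} {i : Fin (suc m)} → i ≡ fromℕ m → toℕ (next i) ≡ 0
toℕ-next-last refl = cong toℕ next-fromℕ

next-injective : ∀ {m} → Injective _≡_ _≡_ (next {suc m})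
next-injective {m} {i} {j} eq = cases (i ≟ fromℕ m) (j ≟ fromℕ m)
  where
  open ≡-Reasoning
  cases : Dec (i ≡ fromℕ m) → Dec (j ≡ fromℕ m) → i ≡ j
  cases (yes i≡last) (yes j≡last) = trans i≡last (sym j≡last)
  cases (yes i≡last) (no  j≢last) = ⊥-elim (0≢1+n (begin
    0             ≡⟨ toℕ-next-last i≡last ⟨
    toℕ (next i)  ≡⟨ cong toℕ eq ⟩
    toℕ (next j)  ≡⟨ toℕ-next j j≢last ⟩
    suc (toℕ j)   ∎))
  cases (no  i≢last) (yes j≡last) = ⊥-elim (0≢1+n (begin
    0             ≡⟨ toℕ-next-last j≡last ⟨
    toℕ (next j)  ≡⟨ cong toℕ eq ⟨
    toℕ (next i)  ≡⟨ toℕ-next i i≢last ⟩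
    suc (toℕ i)   ∎))
  cases (no  i≢last) (no  j≢last) = Finₚ.toℕ-injective (suc-injective (begin
    suc (toℕ i)   ≡⟨ toℕ-next i i≢last ⟨
    toℕ (next i)  ≡⟨ cong toℕ eq ⟩
    toℕ (next j)  ≡⟨ toℕ-next j j≢last ⟩
    suc (toℕ j)   ∎))

next-≢ : ∀ {m} (i : Fin (suc (suc m))) → next i ≢ i
next-≢ {m} i next≡i = cases (i ≟ fromℕ (suc m))
  where
  cases : Dec (i ≡ fromℕ (suc m)) → ⊥
  cases (yes i≡last) = 0≢1+n (trans (sym (toℕ-next-last i≡last)) (cong toℕ (trans next≡i i≡last)))
  cases (no  i≢last) = 1+n≢n (trans (sym (toℕ-next i i≢last)) (cong toℕ next≡i))

collinearBound : ℕ → ℕ → ℕ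
collinearBound n k =
  N n * ((N n ∸ 1) * ((n ∸ 1) * ((n ∸ 2) * fallingFactorial (N n ∸ 4) (k ∸ 4))))

collinearBound≤P : ∀ n m → collinearBound n (4 + m) ≤ N n P (3 + m)
collinearBound≤P n m = begin
  collinearBound n (4 + m)
    ≤⟨ *-monoʳ-≤ (N n) (*-monoʳ-≤ (N n ∸ 1) (≤-trans
         (≤-reflexive (sym (*-assoc (n ∸ 1) (n ∸ 2) _)))
         (*-mono-≤ ([n∸1]*[n∸2]≤n*n+n∸1 n) (fallingFactorial-monoˡ-≤ m X∸3≤X∸1∸1)))) ⟩
  fallingFactorial (N n) (3 + m)
    ≡⟨ fallingFactorial≡P (N n) (3 + m) ⟩
  N n P (3 + m) ∎
  where
  open ≤-Reasoning
  X : ℕ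
  X = n * n + n
  X∸3≤X∸1∸1 : X ∸ 3 ≤ X ∸ 1 ∸ 1
  X∸3≤X∸1∸1 = ≤-trans (≤-reflexive (sym (∸-+-assoc X 1 2))) (∸-monoʳ-≤ (X ∸ 1) (s≤s z≤n))

module _ {n : ℕ} (Π : ProjectivePlane n) where
  open ProjectivePlane Π

  lineThrough-incˡ : ∀ {A B} → A ≢ B → I A (lineThrough Π A B)
  lineThrough-incˡ {A} {B} A≢B with A ≟ B
  ... | yes A≡B = ⊥-elim (A≢B A≡B)
  ... | no  A≢B = join-incˡ A B A≢B

  lineThrough-incʳ : ∀ {A B} → A ≢ B → I B (lineThrough Π A B)
  lineThrough-incʳ {A} {B} A≢B with A ≟ B
  ... | yes A≡B = ⊥-elim (A≢B A≡B)
  ... | no  A≢B = join-incʳ A B A≢B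

  pointsOn : Fin (N n) → List (Fin (N n))
  pointsOn L = filter (λ Z → I? Z L) (allFin (N n))

  pointsOn-unique : ∀ L → Unique (pointsOn L)
  pointsOn-unique L = Unique.filter⁺ (λ Z → I? Z L) (Unique.allFin⁺ (N n))

  ∈-pointsOn : ∀ {Z L} → I Z L → Z ∈ pointsOn L
  ∈-pointsOn {Z} {L} = ∈-filter⁺ (λ Z → I? Z L) (∈-allFin Z)

  length-pointsOn∖ : ∀ {L rs} → Unique rs → All (_∈ pointsOn L) rs →
                     length (pointsOn L ∖ rs) ≡ suc n ∸ length rs
  length-pointsOn∖ {L} {rs} urs rs⊆L =
    trans (length-∖ (pointsOn-unique L) urs rs⊆L) (cong (_∸ length rs) (line-size L))

  module CollinearCount {k} {a b c d : Fin k}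
    (b∉ : All (b ≢_) (a ∷ []))
    (c∉ : All (c ≢_) (b ∷ a ∷ []))
    (d∉ : All (d ≢_) (c ∷ b ∷ a ∷ [])) where

    Collinear : Pred (Vec (Fin (N n)) k) 0ℓ
    Collinear v = Distinct v
                × I (lookup v c) (lineThrough Π (lookup v a) (lookup v b))
                × I (lookup v d) (lineThrough Π (lookup v a) (lookup v b))

    rest : ℕ
    rest = fallingFactorial (N n ∸ 4) (k ∸ 4)

    count₄ : ∀ {α β γ δ} → Unique (δ ∷ γ ∷ β ∷ α ∷ []) → ∀ {ys} → Unique ys →
             All (Fixes (d ∷ c ∷ b ∷ a ∷ []) (δ ∷ γ ∷ β ∷ α ∷ []) ∩ Collinear) ys →
             length ys ≤ rest
    count₄ uw uy h =
      extensions-count (d∉ ∷ c∉ ∷ b∉ ∷ [] ∷ []) uw uy (All.map (λ (fx , inj , _) → fx , inj) h)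

    module OnLine {α β} (β∈ : β ∈ allFin (N n) ∖ (α ∷ [])) where

      L : Fin (N n)
      L = lineThrough Π α β

      β∉ : All (β ≢_) (α ∷ [])
      β∉ = proj₂ (∈-∖⁻ (allFin (N n)) (α ∷ []) β∈)

      α≢β : α ≢ β
      α≢β = All.head β∉ ∘ sym

      onL : ∀ {v qs ws} → Fixes (b ∷ a ∷ qs) (β ∷ α ∷ ws) v → ∀ {Z} →
            I Z (lineThrough Π (lookup v a) (lookup v b)) → I Z L
      onL (eb ∷ ea ∷ _) = subst (I _) (cong₂ (lineThrough Π) ea eb)

      α∈L : α ∈ pointsOn L
      α∈L = ∈-pointsOn (lineThrough-incˡ α≢β)

      β∈L : β ∈ pointsOn L
      β∈L = ∈-pointsOn (lineThrough-incʳ α≢β)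

      count₃ : ∀ {γ} → γ ∈ pointsOn L ∖ (β ∷ α ∷ []) → ∀ {ys} → Unique ys →
               All (Fixes (c ∷ b ∷ a ∷ []) (γ ∷ β ∷ α ∷ []) ∩ Collinear) ys →
               length ys ≤ (n ∸ 2) * rest
      count₃ {γ} γ∈ {ys} uy h = begin
        length ys       ≤⟨ union-bound (λ δ → _at d ≟ δ) C ys (All.map choice h) bound ⟩
        length C * rest ≡⟨ cong (_* rest) (length-pointsOn∖ uγβα (γ∈L ∷ β∈L ∷ α∈L ∷ [])) ⟩
        (n ∸ 2) * rest  ∎
        where
        open ≤-Reasoning
        C : List (Fin (N n))
        C = pointsOn L ∖ (γ ∷ β ∷ α ∷ [])
        γ∈L : γ ∈ pointsOn L
        γ∈L = proj₁ (∈-∖⁻ (pointsOn L) (β ∷ α ∷ []) γ∈)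
        uγβα : Unique (γ ∷ β ∷ α ∷ [])
        uγβα = proj₂ (∈-∖⁻ (pointsOn L) (β ∷ α ∷ []) γ∈) ∷ β∉ ∷ [] ∷ []
        choice : ∀ {v} → (Fixes (c ∷ b ∷ a ∷ []) (γ ∷ β ∷ α ∷ []) ∩ Collinear) v → lookup v d ∈ C
        choice (fx@(_ ∷ fxba) , inj , _ , d∈ab) =
          ∈-∖⁺ (∈-pointsOn (onL fxba d∈ab)) (fresh inj fx d∉)
        bound : ∀ {δ} → δ ∈ C → length (fixing d δ ys) ≤ rest
        bound δ∈ = count₄ (proj₂ (∈-∖⁻ (pointsOn L) (γ ∷ β ∷ α ∷ []) δ∈) ∷ uγβα)
                          (Unique.filter⁺ (_at d ≟ _) uy) (fixing⁺ h)

      count₂ : ∀ {ys} → Unique ys → All (Fixes (b ∷ a ∷ []) (β ∷ α ∷ []) ∩ Collinear) ys →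
               length ys ≤ (n ∸ 1) * ((n ∸ 2) * rest)
      count₂ {ys} uy h = begin
        length ys                  ≤⟨ union-bound (λ γ → _at c ≟ γ) C ys (All.map choice h) bound ⟩
        length C * _               ≡⟨ cong (_* _) (length-pointsOn∖ uβα (β∈L ∷ α∈L ∷ [])) ⟩
        (n ∸ 1) * ((n ∸ 2) * rest) ∎
        where
        open ≤-Reasoning
        C : List (Fin (N n))
        C = pointsOn L ∖ (β ∷ α ∷ [])
        uβα : Unique (β ∷ α ∷ [])
        uβα = β∉ ∷ [] ∷ []
        choice : ∀ {v} → (Fixes (b ∷ a ∷ []) (β ∷ α ∷ []) ∩ Collinear) v → lookup v c ∈ C
        choice (fx , inj , c∈ab , _) = ∈-∖⁺ (∈-pointsOn (onL fx c∈ab)) (fresh inj fx c∉)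
        bound : ∀ {γ} → γ ∈ C → length (fixing c γ ys) ≤ (n ∸ 2) * rest
        bound γ∈ = count₃ γ∈ (Unique.filter⁺ (_at c ≟ _) uy) (fixing⁺ h)

    count₁ : ∀ {α ys} → Unique ys → All (Fixes (a ∷ []) (α ∷ []) ∩ Collinear) ys →
             length ys ≤ (N n ∸ 1) * ((n ∸ 1) * ((n ∸ 2) * rest))
    count₁ {α} {ys} uy h = begin
      length ys    ≤⟨ union-bound (λ β → _at b ≟ β) C ys (All.map choice h) bound ⟩
      length C * _ ≡⟨ cong (_* _) (length-allFin∖ (α ∷ []) ([] ∷ [])) ⟩
      (N n ∸ 1) * ((n ∸ 1) * ((n ∸ 2) * rest)) ∎
      where
      open ≤-Reasoning
      C : List (Fin (N n))
      C = allFin (N n) ∖ (α ∷ [])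
      choice : ∀ {v} → (Fixes (a ∷ []) (α ∷ []) ∩ Collinear) v → lookup v b ∈ C
      choice (fx , inj , _) = ∈-∖⁺ (∈-allFin _) (fresh inj fx b∉)
      bound : ∀ {β} → β ∈ C → length (fixing b β ys) ≤ (n ∸ 1) * ((n ∸ 2) * rest)
      bound β∈ = OnLine.count₂ β∈ (Unique.filter⁺ (_at b ≟ _) uy) (fixing⁺ h)

    count₀ : ∀ {ys} → Unique ys → All Collinear ys → length ys ≤ collinearBound n k
    count₀ {ys} uy h = begin
      length ys
        ≤⟨ union-bound (λ α → _at a ≟ α) (allFin (N n)) ys (All.map (λ {v} → choice {v}) h) bound ⟩
      length (allFin (N n)) * K
        ≡⟨ cong (_* K) (length-allFin (N n)) ⟩
      collinearBound n k ∎
      where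
      open ≤-Reasoning
      K : ℕ
      K = (N n ∸ 1) * ((n ∸ 1) * ((n ∸ 2) * rest))
      choice : ∀ {v} → Collinear v → lookup v a ∈ allFin (N n)
      choice {v} _ = ∈-allFin (lookup v a)
      bound : ∀ {α} → α ∈ allFin (N n) → length (fixing a α ys) ≤ K
      bound _ = count₁ (Unique.filter⁺ (_at a ≟ _) uy) (fixing⁺ (All.map ([] ,_) h))

  side : ∀ {k} → Vec (Fin (N n)) k → Fin k → Fin (N n)
  side v i = lineThrough Π (lookup v i) (lookup v (next i))

  repeated-side : ∀ {k} (v : Vec (Fin (N n)) (suc k)) → numSideLines Π (suc k) v ≡ k →
                  ∃₂ λ i j → i ≢ j × side v i ≡ side v j
  repeated-side {k} v count
    with Finₚ.any? (λ i → Finₚ.any? λ j → ¬? (i ≟ j) ×-dec (side v i ≟ side v j))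
  ... | yes repeated = repeated
  ... | no none = ⊥-elim (1+n≢n (trans (sym distinct-count) count))
    where
    side-injective : Injective _≡_ _≡_ (side v)
    side-injective {i} {j} same with i ≟ j
    ... | yes i≡j = i≡j
    ... | no  i≢j = ⊥-elim (none (i , j , i≢j , same))
    distinct-count : numSideLines Π (suc k) v ≡ suc k
    distinct-count = begin
      length (deduplicate _≟_ (map (side v) (allFin (suc k))))
        ≡⟨ cong length (deduplicate-unique (Unique.map⁺ side-injective (Unique.allFin⁺ (suc k)))) ⟩
      length (map (side v) (allFin (suc k)))  ≡⟨ length-map (side v) (allFin (suc k)) ⟩
      length (allFin (suc k))                 ≡⟨ length-allFin (suc k) ⟩
      suc k                                   ∎
      where open ≡-Reasoning

  module _ {k : ℕ} where

    SharesSide : Fin (suc (suc k)) → Vec (Fin (N n)) (suc (suc k)) → Set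
    SharesSide i v = Any (λ j → side v i ≡ side v j) (allFin _ ∖ (next i ∷ i ∷ []))

    sharesSide? : ∀ i → Decidable (SharesSide i)
    sharesSide? i v = Any.any? (λ j → side v i ≟ side v j) _

    non-adjacent-share : ∀ {v i j} → (∀ m → side v m ≢ side v (next m)) →
                         i ≢ j → side v i ≡ side v j → i ≢ fromℕ (suc k) →
                         Any (λ i → SharesSide i v) (allFin _ ∖ (fromℕ (suc k) ∷ []))
    non-adjacent-share {v} {i} {j} consecutive i≢j same i≢last =
      lose (∈-∖⁺ (∈-allFin i) (i≢last ∷ []))
           (lose (∈-∖⁺ (∈-allFin j) ((λ { refl → consecutive i same }) ∷ (i≢j ∘ sym) ∷ [])) same)

    InB⇒sharesSide : ∀ {v} → InB Π (suc (suc k)) v →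
                     Any (λ i → SharesSide i v) (allFin _ ∖ (fromℕ (suc k) ∷ []))
    InB⇒sharesSide {v} (_ , count , consecutive) with repeated-side v count
    ... | i , j , i≢j , same = orient (i ≟ fromℕ (suc k))
      where
      orient : Dec (i ≡ fromℕ (suc k)) →
               Any (λ i → SharesSide i v) (allFin _ ∖ (fromℕ (suc k) ∷ []))
      orient (no  i≢last) = non-adjacent-share {v} consecutive i≢j same i≢last
      orient (yes i≡last) = non-adjacent-share {v} consecutive (i≢j ∘ sym) (sym same)
                                                (λ j≡last → i≢j (trans i≡last (sym j≡last)))

    count-sharing : ∀ {i j} → j ∈ allFin _ ∖ (next i ∷ i ∷ []) → ∀ {ys} → Unique ys →
                    All (λ v → InB Π (suc (suc k)) v × side v i ≡ side v j) ys →
                    length ys ≤ collinearBound n (suc (suc k))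
    count-sharing j∈ {[]}    _  _ = z≤n
    count-sharing {i} {j} j∈ {y ∷ ys} uy h =
      CollinearCount.count₀ b∉ c∉ d∉ uy (All.map (λ {v} → collinear {v}) h)
      where
      b∉ : All (next i ≢_) (i ∷ [])
      b∉ = next-≢ i ∷ []
      c∉ : All (j ≢_) (next i ∷ i ∷ [])
      c∉ = proj₂ (∈-∖⁻ (allFin _) (next i ∷ i ∷ []) j∈)
      -- next j ≢ i is read off any member y: its sides j and next j lie on different lines.
      d∉ : All (next j ≢_) (j ∷ next i ∷ i ∷ [])
      d∉ = next-≢ j
         ∷ All.lookup c∉ (there (here refl)) ∘ next-injective
         ∷ (λ next-j≡i → let (_ , _ , consecutive) , same = All.head h in
              consecutive j (trans (sym same) (cong (side y) (sym next-j≡i))))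
         ∷ []
      collinear : ∀ {v} → InB Π (suc (suc k)) v × side v i ≡ side v j →
                  CollinearCount.Collinear b∉ c∉ d∉ v
      collinear {v} ((quasi , _) , same) =
        quasi ,
        subst (I _) (sym same) (lineThrough-incˡ Pj≢Pj+1) ,
        subst (I _) (sym same) (lineThrough-incʳ Pj≢Pj+1)
        where
        Pj≢Pj+1 : lookup v j ≢ lookup v (next j)
        Pj≢Pj+1 e = next-≢ j (sym (quasi _ _ e))

    InB-count : ∀ {xs} → Unique xs → All (InB Π (suc (suc k))) xs →
              length xs ≤ suc k * (k * collinearBound n (suc (suc k)))
    InB-count {xs} ux ax = begin
      length xs
        ≤⟨ union-bound sharesSide? S xs (All.map (λ {v} → InB⇒sharesSide {v}) ax) bound ⟩
      length S * K
        ≡⟨ cong (_* K) (length-allFin∖ (fromℕ (suc k) ∷ []) ([] ∷ [])) ⟩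
      suc k * K ∎
      where
      open ≤-Reasoning
      S : List (Fin (suc (suc k)))
      S = allFin _ ∖ (fromℕ (suc k) ∷ [])
      K : ℕ
      K = k * collinearBound n (suc (suc k))
      bound : ∀ {i} → i ∈ S → length (filter (sharesSide? i) xs) ≤ K
      bound {i} _ = begin
        length xs₁
          ≤⟨ union-bound (λ j v → side v i ≟ side v j) S′ xs₁ (all-filter _ xs) bound₁ ⟩
        length S′ * collinearBound n (suc (suc k))
          ≡⟨ cong (_* collinearBound n (suc (suc k))) S′-length ⟩
        k * collinearBound n (suc (suc k)) ∎
        where
        xs₁ : List (Vec (Fin (N n)) (suc (suc k)))
        xs₁ = filter (sharesSide? i) xs
        S′ : List (Fin (suc (suc k)))
        S′ = allFin _ ∖ (next i ∷ i ∷ [])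
        S′-length : length S′ ≡ k
        S′-length = length-allFin∖ (next i ∷ i ∷ []) ((next-≢ i ∷ []) ∷ [] ∷ [])
        bound₁ : ∀ {j} → j ∈ S′ →
                 length (filter (λ v → side v i ≟ side v j) xs₁) ≤ collinearBound n (suc (suc k))
        bound₁ {j} j∈ = count-sharing j∈
          (Unique.filter⁺ _ (Unique.filter⁺ (sharesSide? i) ux))
          (All.zipWith (λ (same , inB) → inB , same)
            (all-filter _ xs₁ , all-filter⁺ _ (all-filter⁺ (sharesSide? i) ax)))

lemma5 : (n : ℕ) (Π : ProjectivePlane n) (k : ℕ) → 4 ≤ k →
    (xs : List (Vec (Fin (N n)) k)) → Unique xs → All (InB Π k) xs →
    length xs ≤ (k ∸ 1) * (k ∸ 2) * (N n P (k ∸ 1))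
lemma5 n Π (suc (suc (suc (suc m)))) (s≤s (s≤s (s≤s (s≤s _)))) xs ux ax = begin
  length xs
    ≤⟨ InB-count Π ux ax ⟩
  (3 + m) * ((2 + m) * collinearBound n (4 + m))
    ≤⟨ *-monoʳ-≤ (3 + m) (*-monoʳ-≤ (2 + m) (collinearBound≤P n m)) ⟩
  (3 + m) * ((2 + m) * (N n P (3 + m)))
    ≡⟨ *-assoc (3 + m) (2 + m) (N n P (3 + m)) ⟨
  (3 + m) * (2 + m) * (N n P (3 + m)) ∎
  where open ≤-Reasoning
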